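{- Let $W$ be a finite Coxeter group with reflection set $T$, let $\star$ be the twisted shuffle product on $\mathcal{T}(k^T)$ and $\mathcal{N}$ the $\star$-subalgebra generated by $T$. For $(w,j)\in W\times\mathbb{N}$ let $\mathcal{N}_{(w,j)}=\operatorname{Span}_k\{t_1\star\cdots\star t_j: t_i\in T,\ t_1\cdots t_j=w\}$. Then $\mathcal{N}=\bigoplus_{(w,j)\in W\times\mathbb{N}}\mathcal{N}_{(w,j)}$, $\mathcal{N}_{(w,j)}\star\mathcal{N}_{(w',j')}\subset\mathcal{N}_{(ww',j+j')}$, and if $\dim\mathcal{N}_{(w,j)}>0$ then $\ell_T(w)=j-2i$ for some $i\in\mathbb{N}$.
   Context: For $t,u\in W$, $t^u=u^{ -1}tu$. $\ell_T(w)$ is the minimal number of reflections whose product is $w$. The twisted shuffle product $\star$ on the tensor algebra $\mathcal{T}(k^T)$ is defined recursively on the basis of tensors of reflections by $(t_1\otimes\cdots\otimes t_i)\star(u_1\otimes\cdots\otimes u_j)=t_1\otimes\big((t_2\otimes\cdots\otimes t_i)\star(u_1\otimes\cdots\otimes u_j)\big)+(-1)^i\,u_1\otimes\big((t_1^{u_1}\otimes\cdots\otimes t_i^{u_1})\star(u_2\otimes\cdots\otimes u_j)\big)$, with the empty tensor $1$ as unit. -}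

module Defs where

open import Level using (0ℓ)
open import Data.Nat using (ℕ; zero; suc; _∸_; _≤_) renaming (_+_ to _+ℕ_; _*_ to _*ℕ_)
open import Data.Fin using (Fin)
open import Data.Fin.Properties using () renaming (_≟_ to _≟F_)
open import Data.Bool using (if_then_else_)
open import Data.List using (List; []; _∷_; _++_; map; length; concatMap; foldr)
open import Data.List.Relation.Unary.All using (All)
open import Data.List.Relation.Binary.Pointwise as PW using (Pointwise)
open import Data.Product using (Σ; ∃; _×_; _,_; proj₁; proj₂)
open import Relation.Nullary using (¬_; Dec; yes; no; does)
open import Relation.Nullary.Decidable using (map′)
open import Relation.Binary using (Decidable)
import Relation.Binary.PropositionalEquality as ≡
open import Algebra.Bundles using (CommutativeRing; Group)
open import Function.Bundles using (Inverse)

record Field : Set₁ where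
  field
    commutativeRing : CommutativeRing 0ℓ 0ℓ
  open CommutativeRing commutativeRing public
  field
    1≉0     : ¬ (1# ≈ 0#)
    inverse : ∀ x → ¬ (x ≈ 0#) → ∃ λ y → x * y ≈ 1#

module GroupOps (G : Group 0ℓ 0ℓ) where
  open Group G

  pow : Carrier → ℕ → Carrier
  pow x zero    = ε
  pow x (suc m) = x ∙ pow x m

  prod : List Carrier → Carrier
  prod = foldr _∙_ ε

  conj : Carrier → Carrier → Carrier
  conj t u = (u ⁻¹ ∙ t) ∙ u

finite⇒dec : (W : Group 0ℓ 0ℓ) (n : ℕ) →
             Inverse (Group.setoid W) (≡.setoid (Fin n)) →
             Decidable (Group._≈_ W)
finite⇒dec W n fin x y =
  map′ (λ p → Group.trans W (Group.sym W (inverseʳ ≡.refl))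
                 (Group.trans W (from-cong p) (inverseʳ ≡.refl)))
       to-cong (to x ≟F to y)
  where open Inverse fin

-- Coxeter systems (W , S), defined by the presentation
--   W = ⟨ S ∣ (s t)^{m(s,t)} = e ⟩ ,  m(s,t) = order of s t in W,
-- expressed by the universal property: every map f : S → G into a
-- group satisfying the relations (f s · f t)^m = e whenever
-- (s t)^m = e in W extends to a group homomorphism W → G.

record IsCoxeterSystem (W : Group 0ℓ 0ℓ) (S : Group.Carrier W → Set) : Set₁ where
  open Group W
  open GroupOps W
  field
    involutions : ∀ s → S s → ¬ (s ≈ ε) × (s ∙ s ≈ ε)
    generates   : ∀ w → ∃ λ (ss : List Carrier) → All S ss × prod ss ≈ w
    presentation :
      (G : Group 0ℓ 0ℓ) (f : ∀ s → S s → Group.Carrier G) →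
      (∀ s s' (p : S s) (p' : S s') → s ≈ s' → Group._≈_ G (f s p) (f s' p')) →
      (∀ s t (p : S s) (q : S t) (m : ℕ) → pow (s ∙ t) m ≈ ε →
         Group._≈_ G (GroupOps.pow G (Group._∙_ G (f s p) (f t q)) m) (Group.ε G)) →
      ∃ λ (φ : Carrier → Group.Carrier G) →
          (∀ x y → x ≈ y → Group._≈_ G (φ x) (φ y))
        × (∀ x y → Group._≈_ G (φ (x ∙ y)) (Group._∙_ G (φ x) (φ y)))
        × (∀ s (p : S s) → Group._≈_ G (φ s) (f s p))

-- Elements are finite formal k-linear combinations of words (tensors)
-- t₁ ⊗ ⋯ ⊗ tᵢ, represented as lists of (coefficient , word); two such
-- combinations are equal iff all their coefficients agree.  Words are
-- taken over W; 𝒯(k^T) is the subspace spanned by words in reflections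
-- (it is closed under ⋆, and everything below lives in it).

module TwistedShuffle (K : Field) (W : Group 0ℓ 0ℓ)
                      (_≟_ : Decidable (Group._≈_ W))
                      (S : Group.Carrier W → Set) where

  open Field K renaming (Carrier to k; _≈_ to _≈k_)
  open Group W renaming (Carrier to Wc; _∙_ to _·_; ε to e; _≈_ to _≈w_;
                         _⁻¹ to inv; refl to refl-w; sym to sym-w; trans to trans-w)
  open GroupOps W

  IsRefl : Wc → Set
  IsRefl t = ∃ λ s → ∃ λ u → S s × t ≈w conj s u

  Tensor : Set
  Tensor = List (k × List Wc)

  _≟word_ : Decidable (Pointwise _≈w_)
  _≟word_ = PW.decidable _≟_

  coeff : Tensor → List Wc → k
  coeff []            u = 0#
  coeff ((c , v) ∷ x) u = if does (v ≟word u) then c + coeff x u else coeff x u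

  infix 4 _≋_
  _≋_ : Tensor → Tensor → Set
  x ≋ y = ∀ u → coeff x u ≈k coeff y u

  zeroT : Tensor
  zeroT = []

  oneT : Tensor
  oneT = (1# , []) ∷ []

  gen : Wc → Tensor
  gen t = (1# , t ∷ []) ∷ []

  _⊕_ : Tensor → Tensor → Tensor
  _⊕_ = _++_

  scale : k → Tensor → Tensor
  scale c = map (λ p → (c * proj₁ p , proj₂ p))

  prefix : Wc → Tensor → Tensor
  prefix t = map (λ p → (proj₁ p , t ∷ proj₂ p))

  sign : ℕ → k
  sign zero    = 1#
  sign (suc i) = - (sign i)

  shw : List Wc → List Wc → Tensor
  shw []       v        = (1# , v) ∷ []
  shw (t ∷ ts) []       = (1# , t ∷ ts) ∷ []
  shw (t ∷ ts) (u ∷ us) =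
    prefix t (shw ts (u ∷ us))
    ⊕ scale (sign (length (t ∷ ts)))
            (prefix u (shw (map (λ x → conj x u) (t ∷ ts)) us))

  infixr 7 _⋆_
  _⋆_ : Tensor → Tensor → Tensor
  x ⋆ y = concatMap (λ p → concatMap (λ q →
            scale (proj₁ p * proj₁ q) (shw (proj₂ p) (proj₂ q))) y) x

  sumT : List Tensor → Tensor
  sumT = foldr _⊕_ zeroT

  starProd : List Wc → Tensor
  starProd []       = oneT
  starProd (t ∷ ts) = gen t ⋆ starProd ts

  data InN : Tensor → Set where
    n-one   : InN oneT
    n-gen   : ∀ t → IsRefl t → InN (gen t)
    n-add   : ∀ {x y} → InN x → InN y → InN (x ⊕ y)
    n-scale : ∀ c {x} → InN x → InN (scale c x)
    n-mul   : ∀ {x y} → InN x → InN y → InN (x ⋆ y)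
    n-resp  : ∀ {x y} → x ≋ y → InN x → InN y

  InNwj : Wc → ℕ → Tensor → Set
  InNwj w j x =
    ∃ λ (L : List (k × List Wc)) →
        All (λ p → length (proj₂ p) ≡.≡ j × All IsRefl (proj₂ p) × prod (proj₂ p) ≈w w) L
      × x ≋ sumT (map (λ p → scale (proj₁ p) (starProd (proj₂ p))) L)

  IsReflLength : Wc → ℕ → Set
  IsReflLength w l =
      (∃ λ ts → length ts ≡.≡ l × All IsRefl ts × prod ts ≈w w)
    × (∀ ts → All IsRefl ts → prod ts ≈w w → l ≤ length ts)

  Component : Set
  Component = Wc × ℕ × Tensor

  index≠ : Component → Component → Set
  index≠ (w , j , _) (w' , j' , _) = ¬ (w ≈w w' × j ≡.≡ j')

  InComponent : Component → Set
  InComponent (w , j , x) = InNwj w j x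

  vec : Component → Tensor
  vec (_ , _ , x) = x

  Lemma7p3 : Set
  Lemma7p3 =
      (∀ w j x → InNwj w j x → InN x)
    × (∀ x → InN x → ∃ λ (L : List Component) →
          All InComponent L × x ≋ sumT (map vec L))
    × (∀ (L : List Component) →
          AllPairs index≠ L → All InComponent L → sumT (map vec L) ≋ zeroT →
          All (λ c → vec c ≋ zeroT) L)
    × (∀ w j w' j' x y → InNwj w j x → InNwj w' j' y →
          InNwj (w · w') (j +ℕ j') (x ⋆ y))
    × (∀ w j → (∃ λ x → InNwj w j x × ¬ (x ≋ zeroT)) →
          ∃ λ i → 2 *ℕ i ≤ j × IsReflLength w (j ∸ 2 *ℕ i))
    where open import Data.List.Relation.Unary.AllPairs using (AllPairs)

-- Shuffling t₁ ⊗ ⋯ ⊗ tᵢ with u₁ ⊗ ⋯ only conjugates letters, and u · tᵘ = t · u, so every word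
-- in t₁ ⋆ ⋯ ⋆ tⱼ has length j and product t₁ ⋯ tⱼ.  Thus 𝒩_(w,j) is supported on the words of
-- length j and product w, which makes the sum of the 𝒩_(w,j) direct; that they span 𝒩 and
-- multiply as graded pieces follows from bilinearity and associativity of ⋆.  If 𝒩_(w,j) ≠ 0,
-- w is a product of j reflections, and j − ℓ_T(w) is even because the character W → ℤ₂
-- sending every simple reflection to 1 sends every reflection to 1.

module Submission where

open import Defs
open import Level using (0ℓ)
open import Data.Nat using (ℕ; zero; suc; _∸_; _≤_; z≤n; s≤s) renaming (_+_ to _+ℕ_; _*_ to _*ℕ_; _≟_ to _≟ℕ_)
import Data.Nat.Properties as ℕ
open import Data.Bool using (Bool; true; false; not; _xor_; if_then_else_)
open import Data.Bool.Properties using (xor-∧-commutativeRing; xor-same; xor-comm; not-injective; ¬-not)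
open import Data.Fin using (Fin)
import Data.Fin.Properties as Fin
open import Data.List using (List; []; _∷_; _++_; map; length; concatMap; cartesianProductWith)
open import Data.List.Properties using (length-map; length-++)
open import Data.List.Relation.Unary.All as All using (All; []; _∷_)
open import Data.List.Relation.Unary.All.Properties using (++⁺; map⁺; gmap⁺)
open import Data.List.Relation.Unary.AllPairs using (AllPairs; []; _∷_)
open import Data.List.Relation.Unary.Any as Any using (Any; here; there)
open import Data.List.Relation.Binary.Pointwise as PW using (Pointwise; []; _∷_)
open import Data.Product using (Σ; ∃; _×_; _,_; proj₁; proj₂; map₂)
open import Data.Empty using (⊥-elim)
open import Function using (_∘_)
open import Relation.Nullary using (¬_; Dec; yes; no; does; contradiction)
open import Relation.Nullary.Decidable using (map′; _×-dec_; dec-true)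
open import Relation.Binary using (Decidable; Setoid)
import Relation.Binary.PropositionalEquality as ≡
open import Algebra.Bundles using (Group; CommutativeRing)
open import Function.Bundles using (Inverse)

least-witness : ∀ {P : ℕ → Set} → (∀ m → Dec (P m)) → ∀ m → P m →
                ∃ λ l → P l × (∀ k → P k → l ≤ k)
least-witness P? zero    p = 0 , p , λ _ _ → z≤n
least-witness P? (suc m) p with P? 0
... | yes p₀ = 0 , p₀ , λ _ _ → z≤n
... | no ¬p₀ with least-witness (λ k → P? (suc k)) m p
...   | l , pl , least = suc l , pl , λ { zero p₀ → ⊥-elim (¬p₀ p₀) ; (suc k) pk → s≤s (least k pk) }

All-cartesianProductWith : ∀ {A B C : Set} {P : A → Set} {Q : B → Set} {R : C → Set} {f : A → B → C} →
                           (∀ {x y} → P x → Q y → R (f x y)) →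
                           ∀ {xs ys} → All P xs → All Q ys → All R (cartesianProductWith f xs ys)
All-cartesianProductWith f⁺ []       qs = []
All-cartesianProductWith f⁺ (p ∷ ps) qs = ++⁺ (gmap⁺ (f⁺ p) qs) (All-cartesianProductWith f⁺ ps qs)

xor-cancelˡ : ∀ a {b c} → a xor b ≡.≡ a xor c → b ≡.≡ c
xor-cancelˡ false eq = eq
xor-cancelˡ true  eq = not-injective eq

module GroupProperties (G : Group 0ℓ 0ℓ) where
  open Group G
  open GroupOps G
  open import Algebra.Properties.Group G using (⁻¹-anti-homo-∙; ε⁻¹≈ε; inverseˡ-unique)
  open import Algebra.Solver.Monoid monoid using (solve; _⊜_; _⊕_)
  open import Relation.Binary.Reasoning.Setoid setoid

  conj-cong : ∀ {t t' u u'} → t ≈ t' → u ≈ u' → conj t u ≈ conj t' u'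
  conj-cong t≈t' u≈u' = ∙-cong (∙-cong (⁻¹-cong u≈u') t≈t') u≈u'

  conj-ε : ∀ u → conj ε u ≈ ε
  conj-ε u = trans (∙-congʳ (identityʳ _)) (inverseˡ u)

  conj-by-ε : ∀ x → conj x ε ≈ x
  conj-by-ε x = trans (identityʳ _) (trans (∙-congʳ ε⁻¹≈ε) (identityˡ x))

  conj-conj : ∀ x a b → conj (conj x a) b ≈ conj x (a ∙ b)
  conj-conj x a b = begin
    (b ⁻¹ ∙ ((a ⁻¹ ∙ x) ∙ a)) ∙ b
      ≈⟨ solve 5 (λ p q y r s → ((p ⊕ ((q ⊕ y) ⊕ r)) ⊕ s) ⊜ (((p ⊕ q) ⊕ y) ⊕ (r ⊕ s))) refl (b ⁻¹) (a ⁻¹) x a b ⟩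
    ((b ⁻¹ ∙ a ⁻¹) ∙ x) ∙ (a ∙ b) ≈⟨ ∙-congʳ (∙-congʳ (sym (⁻¹-anti-homo-∙ a b))) ⟩
    ((a ∙ b) ⁻¹ ∙ x) ∙ (a ∙ b)    ∎

  ∙-conj : ∀ u p → u ∙ conj p u ≈ p ∙ u
  ∙-conj u p = begin
    u ∙ ((u ⁻¹ ∙ p) ∙ u) ≈⟨ solve 3 (λ a b c → a ⊕ ((b ⊕ c) ⊕ a) ⊜ ((a ⊕ b) ⊕ c) ⊕ a) refl u (u ⁻¹) p ⟩
    ((u ∙ u ⁻¹) ∙ p) ∙ u ≈⟨ ∙-congʳ (trans (∙-congʳ (inverseʳ u)) (identityˡ p)) ⟩
    p ∙ u                ∎

  ∙-conj-∙ : ∀ u p q → u ∙ (conj p u ∙ q) ≈ p ∙ (u ∙ q)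
  ∙-conj-∙ u p q = trans (sym (assoc _ _ _)) (trans (∙-congʳ (∙-conj u p)) (assoc _ _ _))

  conj-homo-∙ : ∀ t p u → conj t u ∙ conj p u ≈ conj (t ∙ p) u
  conj-homo-∙ t p u = begin
    ((u ⁻¹ ∙ t) ∙ u) ∙ conj p u ≈⟨ assoc _ _ _ ⟩
    (u ⁻¹ ∙ t) ∙ (u ∙ conj p u) ≈⟨ ∙-congˡ (∙-conj u p) ⟩
    (u ⁻¹ ∙ t) ∙ (p ∙ u)        ≈⟨ solve 4 (λ a b c d → (a ⊕ b) ⊕ (c ⊕ d) ⊜ (a ⊕ (b ⊕ c)) ⊕ d) refl (u ⁻¹) t p u ⟩
    (u ⁻¹ ∙ (t ∙ p)) ∙ u        ∎

  conj-swap : ∀ x u v → conj (conj x u) v ≈ conj (conj x v) (conj u v)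
  conj-swap x u v = begin
    conj (conj x u) v       ≈⟨ conj-conj x u v ⟩
    conj x (u ∙ v)          ≈⟨ conj-cong refl (sym (∙-conj v u)) ⟩
    conj x (v ∙ conj u v)   ≈⟨ sym (conj-conj x v (conj u v)) ⟩
    conj (conj x v) (conj u v) ∎

  conj-inverse : ∀ {x y} a → y ≈ conj x a → x ≈ conj y (a ⁻¹)
  conj-inverse {x} {y} a y≈xᵃ = sym (begin
    conj y (a ⁻¹)          ≈⟨ conj-cong y≈xᵃ refl ⟩
    conj (conj x a) (a ⁻¹) ≈⟨ conj-conj x a (a ⁻¹) ⟩
    conj x (a ∙ a ⁻¹)      ≈⟨ conj-cong refl (inverseʳ a) ⟩
    conj x ε               ≈⟨ conj-by-ε x ⟩
    x                      ∎)

  pow-sucʳ : ∀ x m → pow x (suc m) ≈ pow x m ∙ x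
  pow-sucʳ x zero    = trans (identityʳ x) (sym (identityˡ x))
  pow-sucʳ x (suc m) = trans (∙-congˡ (pow-sucʳ x m)) (sym (assoc _ _ _))

  pow-+ : ∀ x a b → pow x (a +ℕ b) ≈ pow x a ∙ pow x b
  pow-+ x zero    b = sym (identityˡ _)
  pow-+ x (suc a) b = trans (∙-congˡ (pow-+ x a b)) (sym (assoc _ _ _))

  -- The conjugating element is r^(k+1) for r = s t: r^k s r^k = s, and r^(-(k+1)) = r^k.
  odd-order⇒conjugate : ∀ s t → s ∙ s ≈ ε → t ∙ t ≈ ε → ∀ k →
                        pow (s ∙ t) (suc (2 *ℕ k)) ≈ ε → t ≈ conj s (pow (s ∙ t) (suc k))
  odd-order⇒conjugate s t s²≈ε t²≈ε k r²ᵏ⁺¹≈ε = sym (begin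
    (pow r (suc k) ⁻¹ ∙ s) ∙ pow r (suc k) ≈⟨ ∙-cong (∙-congʳ (sym rᵏ≈r⁻⁽ᵏ⁺¹⁾)) (pow-sucʳ r k) ⟩
    (pow r k ∙ s) ∙ (pow r k ∙ r)           ≈⟨ sym (assoc _ _ _) ⟩
    ((pow r k ∙ s) ∙ pow r k) ∙ r           ≈⟨ ∙-congʳ (rᵏsrᵏ≈s k) ⟩
    s ∙ (s ∙ t)                             ≈⟨ sym (assoc _ _ _) ⟩
    (s ∙ s) ∙ t                             ≈⟨ trans (∙-congʳ s²≈ε) (identityˡ t) ⟩
    t                                       ∎)
    where
    r = s ∙ t

    rsr≈s : (r ∙ s) ∙ r ≈ s
    rsr≈s = begin
      ((s ∙ t) ∙ s) ∙ (s ∙ t) ≈⟨ solve 2 (λ a b → ((a ⊕ b) ⊕ a) ⊕ (a ⊕ b) ⊜ (a ⊕ (b ⊕ (a ⊕ a))) ⊕ b) refl s t ⟩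
      (s ∙ (t ∙ (s ∙ s))) ∙ t ≈⟨ ∙-congʳ (∙-congˡ (trans (∙-congˡ s²≈ε) (identityʳ t))) ⟩
      (s ∙ t) ∙ t             ≈⟨ trans (assoc _ _ _) (∙-congˡ t²≈ε) ⟩
      s ∙ ε                   ≈⟨ identityʳ s ⟩
      s                       ∎

    rᵏsrᵏ≈s : ∀ k → (pow r k ∙ s) ∙ pow r k ≈ s
    rᵏsrᵏ≈s zero    = trans (identityʳ _) (identityˡ s)
    rᵏsrᵏ≈s (suc k) = begin
      ((r ∙ pow r k) ∙ s) ∙ (r ∙ pow r k) ≈⟨ ∙-congˡ (pow-sucʳ r k) ⟩
      ((r ∙ pow r k) ∙ s) ∙ (pow r k ∙ r)
        ≈⟨ solve 3 (λ a b c → ((a ⊕ b) ⊕ c) ⊕ (b ⊕ a) ⊜ (a ⊕ ((b ⊕ c) ⊕ b)) ⊕ a) refl r (pow r k) s ⟩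
      (r ∙ ((pow r k ∙ s) ∙ pow r k)) ∙ r ≈⟨ ∙-congʳ (∙-congˡ (rᵏsrᵏ≈s k)) ⟩
      (r ∙ s) ∙ r                         ≈⟨ rsr≈s ⟩
      s                                   ∎

    k+suc-k≡suc-2k : k +ℕ suc k ≡.≡ suc (2 *ℕ k)
    k+suc-k≡suc-2k = ≡.trans (ℕ.+-suc k k) (≡.cong (λ m → suc (k +ℕ m)) (≡.sym (ℕ.+-identityʳ k)))

    rᵏ≈r⁻⁽ᵏ⁺¹⁾ : pow r k ≈ pow r (suc k) ⁻¹
    rᵏ≈r⁻⁽ᵏ⁺¹⁾ = inverseˡ-unique (pow r k) (pow r (suc k))
      (trans (sym (pow-+ r k (suc k))) (trans (reflexive (≡.cong (pow r) k+suc-k≡suc-2k)) r²ᵏ⁺¹≈ε))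

ℤ₂ : Group 0ℓ 0ℓ
ℤ₂ = CommutativeRing.+-group xor-∧-commutativeRing

parity : ℕ → Bool
parity = GroupOps.pow ℤ₂ true

pow-false : ∀ m → GroupOps.pow ℤ₂ false m ≡.≡ false
pow-false zero    = ≡.refl
pow-false (suc m) = pow-false m

parity-false⇒even : ∀ m → parity m ≡.≡ false → ∃ λ i → m ≡.≡ 2 *ℕ i
parity-true⇒odd   : ∀ m → parity m ≡.≡ true → ∃ λ i → m ≡.≡ suc (2 *ℕ i)

parity-false⇒even zero    _ = 0 , ≡.refl
parity-false⇒even (suc m) p with parity m in eq
... | true with parity-true⇒odd m eq
...   | i , m≡1+2i = suc i , ≡.trans (≡.cong suc m≡1+2i) (≡.sym (ℕ.*-suc 2 i))

parity-true⇒odd zero    ()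
parity-true⇒odd (suc m) p with parity m in eq
... | false with parity-false⇒even m eq
...   | i , m≡2i = i , ≡.cong suc m≡2i

same-parity⇒even-gap : ∀ {l j} → l ≤ j → parity l ≡.≡ parity j → ∃ λ i → j ≡.≡ l +ℕ 2 *ℕ i
same-parity⇒even-gap {j = j} z≤n  eq = parity-false⇒even j (≡.sym eq)
same-parity⇒even-gap (s≤s l≤j) eq = map₂ (≡.cong suc) (same-parity⇒even-gap l≤j (not-injective eq))

module Coxeter (W : Group 0ℓ 0ℓ) (S : Group.Carrier W → Set) (n : ℕ)
               (finite : Inverse (Group.setoid W) (≡.setoid (Fin n)))
               (cox : IsCoxeterSystem W S) where
  open Group W
  open GroupOps W
  open GroupProperties W
  open import Algebra.Properties.Group W using (\\-leftDividesˡ; y≈x\\z)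
  open IsCoxeterSystem cox
  open Inverse finite using (to; from; strictlyInverseʳ)

  _≟_ : Decidable _≈_
  _≟_ = finite⇒dec W n finite

  infix 4 _∼_
  _∼_ : Carrier → Carrier → Set
  x ∼ y = ∃ λ (i : Fin n) → x ≈ conj y (from i)

  ∼-dec : ∀ x y → Dec (x ∼ y)
  ∼-dec x y = Fin.any? (λ i → x ≟ conj y (from i))

  ≈conj⇒∼ : ∀ {x y} a → x ≈ conj y a → x ∼ y
  ≈conj⇒∼ a x≈yᵃ = to a , trans x≈yᵃ (conj-cong refl (sym (strictlyInverseʳ a)))

  ∼-refl : ∀ x → x ∼ x
  ∼-refl x = ≈conj⇒∼ ε (sym (conj-by-ε x))

  ∼-sym : ∀ {x y} → x ∼ y → y ∼ x
  ∼-sym (i , x≈yⁱ) = ≈conj⇒∼ _ (conj-inverse (from i) x≈yⁱ)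

  ∼-trans : ∀ {x y z} → x ∼ y → y ∼ z → x ∼ z
  ∼-trans {z = z} (i , x≈yⁱ) (j , y≈zʲ) =
    ≈conj⇒∼ (from j ∙ from i) (trans x≈yⁱ (trans (conj-cong y≈zʲ refl) (conj-conj z _ _)))

  ∼-respˡ : ∀ {x y z} → x ≈ y → x ∼ z → y ∼ z
  ∼-respˡ x≈y (i , x≈zⁱ) = i , trans (sym x≈y) x≈zⁱ

  odd-relation⇒∼ : ∀ {s t} → S s → S t → ∀ {m} → pow (s ∙ t) m ≈ ε → parity m ≡.≡ true → t ∼ s
  odd-relation⇒∼ {s} {t} Ss St {m} rel odd with parity-true⇒odd m odd
  ... | k , ≡.refl =
    ≈conj⇒∼ _ (odd-order⇒conjugate s t (proj₂ (involutions s Ss)) (proj₂ (involutions t St)) k rel)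

  record ℤ₂-Hom : Set where
    field
      φ      : Carrier → Bool
      φ-cong : ∀ {x y} → x ≈ y → φ x ≡.≡ φ y
      φ-homo : ∀ x y → φ (x ∙ y) ≡.≡ φ x xor φ y

    φ-ε : φ ε ≡.≡ false
    φ-ε = ≡.trans (φ-cong (sym (identityˡ ε))) (≡.trans (φ-homo ε ε) (xor-same (φ ε)))

    φ-conj : ∀ x u → φ (conj x u) ≡.≡ φ x
    φ-conj x u = xor-cancelˡ (φ u)
      (≡.trans (≡.sym (φ-homo u (conj x u)))
      (≡.trans (φ-cong (∙-conj u x)) (≡.trans (φ-homo x u) (xor-comm (φ x) (φ u)))))
  open ℤ₂-Hom

  extend-to-ℤ₂ : (f : ∀ s → S s → Bool) →
                 (∀ s s' (p : S s) (p' : S s') → s ≈ s' → f s p ≡.≡ f s' p') →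
                 (∀ s t (p : S s) (q : S t) m → pow (s ∙ t) m ≈ ε →
                    GroupOps.pow ℤ₂ (f s p xor f t q) m ≡.≡ false) →
                 Σ ℤ₂-Hom λ h → ∀ s (p : S s) → φ h s ≡.≡ f s p
  extend-to-ℤ₂ f f-cong f-rel with presentation ℤ₂ f f-cong f-rel
  ... | φ , φ-cong , φ-homo , φ-ext =
    record { φ = φ ; φ-cong = φ-cong _ _ ; φ-homo = φ-homo } , φ-ext

  IsReflection : Carrier → Set
  IsReflection t = ∃ λ s → ∃ λ u → S s × t ≈ conj s u

  sign : Σ ℤ₂-Hom λ h → ∀ s → S s → φ h s ≡.≡ true
  sign = extend-to-ℤ₂ (λ _ _ → true) (λ _ _ _ _ _ → ≡.refl) (λ _ _ _ _ m _ → pow-false m)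

  sign-prod-reflections : ∀ ts → All IsReflection ts → φ (proj₁ sign) (prod ts) ≡.≡ parity (length ts)
  sign-prod-reflections []       []       = φ-ε (proj₁ sign)
  sign-prod-reflections (t ∷ ts) ((s , u , Ss , t≈sᵘ) ∷ rs) =
    ≡.trans (φ-homo (proj₁ sign) t (prod ts)) (≡.cong₂ _xor_ sign-t (sign-prod-reflections ts rs))
    where
    sign-t : φ (proj₁ sign) t ≡.≡ true
    sign-t = ≡.trans (φ-cong (proj₁ sign) t≈sᵘ) (≡.trans (φ-conj (proj₁ sign) s u) (proj₂ sign s Ss))

  -- The indicator respects the relations since (s t)^m = ε with m odd makes s and t conjugate.
  class-indicator : ∀ s₀ → Σ ℤ₂-Hom λ h → ∀ s (p : S s) → φ h s ≡.≡ does (∼-dec s s₀)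
  class-indicator s₀ = extend-to-ℤ₂ (λ s _ → does (∼-dec s s₀)) respects relations
    where
    respects : ∀ s s' (p : S s) (p' : S s') → s ≈ s' → does (∼-dec s s₀) ≡.≡ does (∼-dec s' s₀)
    respects s s' _ _ s≈s' with ∼-dec s s₀ | ∼-dec s' s₀
    ... | yes _    | yes _     = ≡.refl
    ... | yes s∼s₀ | no s'≁s₀  = ⊥-elim (s'≁s₀ (∼-respˡ s≈s' s∼s₀))
    ... | no s≁s₀  | yes s'∼s₀ = ⊥-elim (s≁s₀ (∼-respˡ (sym s≈s') s'∼s₀))
    ... | no _     | no _      = ≡.refl

    relations : ∀ s t (p : S s) (q : S t) m → pow (s ∙ t) m ≈ ε →
                GroupOps.pow ℤ₂ (does (∼-dec s s₀) xor does (∼-dec t s₀)) m ≡.≡ false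
    relations s t Ss St m rel with ∼-dec s s₀ | ∼-dec t s₀
    ... | yes _    | yes _    = pow-false m
    ... | no _     | no _     = pow-false m
    ... | yes s∼s₀ | no t≁s₀  = ¬-not λ odd → t≁s₀ (∼-trans (odd-relation⇒∼ Ss St {m} rel odd) s∼s₀)
    ... | no s≁s₀  | yes t∼s₀ = ¬-not λ odd → s≁s₀ (∼-trans (∼-sym (odd-relation⇒∼ Ss St {m} rel odd)) t∼s₀)

  class-meets-word : ∀ s₀ ss → All S ss → φ (proj₁ (class-indicator s₀)) (prod ss) ≡.≡ true →
                     Any (_∼ s₀) ss
  class-meets-word s₀ [] [] φε≡true with ≡.trans (≡.sym (φ-ε (proj₁ (class-indicator s₀)))) φε≡true
  ... | ()
  class-meets-word s₀ (s ∷ ss) (Ss ∷ Sss) φ≡true with ∼-dec s s₀ | proj₂ (class-indicator s₀) s Ss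
  ... | yes s∼s₀ | _     = here s∼s₀
  ... | no _     | φs≡false = there (class-meets-word s₀ ss Sss
          (≡.trans (≡.sym (≡.cong (_xor φ h (prod ss)) φs≡false))
                   (≡.trans (≡.sym (φ-homo h s (prod ss))) φ≡true)))
    where h = proj₁ (class-indicator s₀)

  -- S need not be decidable, but T is: t is a reflection iff it is conjugate to a letter of
  -- one of the chosen words for the elements of W.  For s ∈ S the class indicator of s is
  -- true on s, so the word chosen for s itself contains a conjugate of s.
  letters : Fin n → List Carrier
  letters i = proj₁ (generates (from i))

  letters-simple : ∀ i → All S (letters i)
  letters-simple i = proj₁ (proj₂ (generates (from i)))

  prod-letters : ∀ i → prod (letters i) ≈ from i
  prod-letters i = proj₂ (proj₂ (generates (from i)))

  conjugate-to-letter⇒reflection : ∀ t → (∃ λ i → Any (t ∼_) (letters i)) → IsReflection t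
  conjugate-to-letter⇒reflection t (i , t∼letter) with All.lookupAny (letters-simple i) t∼letter
  ... | Ss , (b , t≈sᵇ) = _ , from b , Ss , t≈sᵇ

  reflection⇒conjugate-to-letter : ∀ t → IsReflection t → ∃ λ i → Any (t ∼_) (letters i)
  reflection⇒conjugate-to-letter t (s , u , Ss , t≈sᵘ) =
    to s , Any.map (λ x∼s → ∼-trans (≈conj⇒∼ u t≈sᵘ) (∼-sym x∼s))
                   (class-meets-word s (letters (to s)) (letters-simple (to s)) φ≡true)
    where
    h = proj₁ (class-indicator s)
    φ≡true : φ h (prod (letters (to s))) ≡.≡ true
    φ≡true = ≡.trans (φ-cong h (trans (prod-letters (to s)) (strictlyInverseʳ s)))
             (≡.trans (proj₂ (class-indicator s) s Ss) (dec-true (∼-dec s s) (∼-refl s)))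

  reflection? : ∀ t → Dec (IsReflection t)
  reflection? t = map′ (conjugate-to-letter⇒reflection t) (reflection⇒conjugate-to-letter t)
    (Fin.any? λ i → Any.any? (λ x → ∼-dec t x) (letters i))

  IsReflection-resp : ∀ {t t'} → t ≈ t' → IsReflection t → IsReflection t'
  IsReflection-resp t≈t' (s , u , Ss , t≈sᵘ) = s , u , Ss , trans (sym t≈t') t≈sᵘ

  Factorisation : ℕ → Carrier → Set
  Factorisation m w = ∃ λ ts → length ts ≡.≡ m × All IsReflection ts × prod ts ≈ w

  factorisation? : ∀ m w → Dec (Factorisation m w)
  factorisation? zero w = map′ (λ ε≈w → [] , ≡.refl , [] , ε≈w) (λ { ([] , _ , _ , ε≈w) → ε≈w }) (ε ≟ w)
  factorisation? (suc m) w =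
    map′ extend shorten (Fin.any? λ i → reflection? (from i) ×-dec factorisation? m (from i ⁻¹ ∙ w))
    where
    extend : (∃ λ i → IsReflection (from i) × Factorisation m (from i ⁻¹ ∙ w)) → Factorisation (suc m) w
    extend (i , r , ts , l , rs , p) = from i ∷ ts , ≡.cong suc l , r ∷ rs ,
                                       trans (∙-congˡ p) (\\-leftDividesˡ (from i) w)
    shorten : Factorisation (suc m) w → ∃ λ i → IsReflection (from i) × Factorisation m (from i ⁻¹ ∙ w)
    shorten (t ∷ ts , l , r ∷ rs , p) =
      to t , IsReflection-resp (sym (strictlyInverseʳ t)) r , ts , ℕ.suc-injective l , rs ,
      trans (y≈x\\z t (prod ts) w p) (∙-congʳ (⁻¹-cong (sym (strictlyInverseʳ t))))

  HasReflectionLength : Carrier → ℕ → Set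
  HasReflectionLength w l = Factorisation l w × (∀ ts → All IsReflection ts → prod ts ≈ w → l ≤ length ts)

  reflection-length : ∀ {w j} → Factorisation j w →
                      ∃ λ i → 2 *ℕ i ≤ j × HasReflectionLength w (j ∸ 2 *ℕ i)
  reflection-length {w} {j} fact@(ts , ≡.refl , rs , ts≈w)
    with least-witness (λ m → factorisation? m w) j fact
  ... | l , shortest@(us , ≡.refl , rs' , us≈w) , least
    with same-parity⇒even-gap (least j fact) same-sign
    where
    same-sign : parity l ≡.≡ parity j
    same-sign = ≡.trans (≡.sym (sign-prod-reflections us rs'))
                (≡.trans (φ-cong (proj₁ sign) (trans us≈w (sym ts≈w))) (sign-prod-reflections ts rs))
  ... | i , j≡l+2i = i , 2i≤j ,
      ≡.subst (HasReflectionLength w) l≡j∸2i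
        (shortest , λ vs rvs vs≈w → least (length vs) (vs , ≡.refl , rvs , vs≈w))
    where
    2i≤j : 2 *ℕ i ≤ j
    2i≤j = ≡.subst (2 *ℕ i ≤_) (≡.sym j≡l+2i) (ℕ.m≤n+m (2 *ℕ i) l)
    l≡j∸2i : l ≡.≡ j ∸ 2 *ℕ i
    l≡j∸2i = ≡.trans (≡.sym (ℕ.m+n∸n≡m l (2 *ℕ i))) (≡.cong (_∸ 2 *ℕ i) (≡.sym j≡l+2i))

module ShuffleAlgebra (K : Field) (W : Group 0ℓ 0ℓ) (_≟_ : Decidable (Group._≈_ W))
                      (S : Group.Carrier W → Set) where
  open TwistedShuffle K W _≟_ S
  open Field K renaming (Carrier to k; _≈_ to _≈k_)
  open Group W using (identityˡ; identityʳ; assoc; ∙-congˡ; ∙-congʳ; ∙-cong)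
    renaming (Carrier to Wc; _∙_ to _·_; ε to e; _≈_ to _≈w_; refl to refl-w; sym to sym-w; trans to trans-w)
  open GroupOps W
  open GroupProperties W
  open import Algebra.Properties.Ring ring using (-1*x≈-x)
  open import Algebra.Solver.Ring.NaturalCoefficients.Default commutativeSemiring
    using (solve; _:=_; _:+_; _:*_)
  open import Relation.Binary.Reasoning.Setoid setoid

  infix 4 _≈W_
  _≈W_ : List Wc → List Wc → Set
  _≈W_ = Pointwise _≈w_

  module ≈W = Setoid (PW.setoid (Group.setoid W))

  Congruent : (List Wc → k) → Set
  Congruent G = ∀ {a b} → a ≈W b → G a ≈k G b

  ev : Tensor → (List Wc → k) → k
  ev []            G = 0#
  ev ((c , v) ∷ x) G = c * G v + ev x G

  -- It coincides with ≋
  -- (≋⇒≃, ≃⇒≋), and ⋆ becomes a composition of such forms (ev-⋆), so every identity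
  -- between tensors is proved in this form.
  infix 4 _≃_
  record _≃_ (x y : Tensor) : Set where
    constructor mk≃
    field ev-≈ : ∀ G → Congruent G → ev x G ≈k ev y G
  open _≃_ public

  ≃-refl : ∀ {x} → x ≃ x
  ≃-refl = mk≃ λ _ _ → refl

  ≃-sym : ∀ {x y} → x ≃ y → y ≃ x
  ≃-sym x≃y = mk≃ λ G G-cong → sym (ev-≈ x≃y G G-cong)

  ≃-trans : ∀ {x y z} → x ≃ y → y ≃ z → x ≃ z
  ≃-trans x≃y y≃z = mk≃ λ G G-cong → trans (ev-≈ x≃y G G-cong) (ev-≈ y≃z G G-cong)

  ev-++ : ∀ x y G → ev (x ++ y) G ≈k ev x G + ev y G
  ev-++ []            y G = sym (+-identityˡ _)
  ev-++ ((c , v) ∷ x) y G = trans (+-congˡ (ev-++ x y G)) (sym (+-assoc _ _ _))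

  ev-scale : ∀ c x G → ev (scale c x) G ≈k c * ev x G
  ev-scale c []            G = sym (zeroʳ c)
  ev-scale c ((d , v) ∷ x) G = trans (+-cong (*-assoc _ _ _) (ev-scale c x G)) (sym (distribˡ _ _ _))

  ev-prefix : ∀ t x G → ev (prefix t x) G ≡.≡ ev x (G ∘ (t ∷_))
  ev-prefix t []            G = ≡.refl
  ev-prefix t ((c , v) ∷ x) G = ≡.cong (c * G (t ∷ v) +_) (ev-prefix t x G)

  ev-cong : ∀ x {H H'} → (∀ v → H v ≈k H' v) → ev x H ≈k ev x H'
  ev-cong []            H≈H' = refl
  ev-cong ((c , v) ∷ x) H≈H' = +-cong (*-congˡ (H≈H' v)) (ev-cong x H≈H')

  ev-zero : ∀ x → ev x (λ _ → 0#) ≈k 0#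
  ev-zero []            = refl
  ev-zero ((c , v) ∷ x) = trans (+-cong (zeroʳ c) (ev-zero x)) (+-identityˡ _)

  ev-+ : ∀ x H H' → ev x (λ v → H v + H' v) ≈k ev x H + ev x H'
  ev-+ []            H H' = sym (+-identityˡ _)
  ev-+ ((c , v) ∷ x) H H' =
    trans (+-cong (distribˡ c (H v) (H' v)) (ev-+ x H H'))
          (solve 4 (λ a b p q → ((a :+ b) :+ (p :+ q)) := ((a :+ p) :+ (b :+ q))) refl _ _ _ _)

  ev-* : ∀ x c H → ev x (λ v → c * H v) ≈k c * ev x H
  ev-* []            c H = sym (zeroʳ c)
  ev-* ((d , v) ∷ x) c H =
    trans (+-cong (solve 3 (λ d c h → (d :* (c :* h)) := (c :* (d :* h))) refl d c (H v)) (ev-* x c H))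
          (sym (distribˡ _ _ _))

  ev-linear : ∀ x H c H' → ev x (λ v → H v + c * H' v) ≈k ev x H + c * ev x H'
  ev-linear x H c H' = trans (ev-+ x H _) (+-congˡ (ev-* x c H'))

  ev-comm : ∀ x y (H : List Wc → List Wc → k) →
            ev x (λ a → ev y (λ b → H a b)) ≈k ev y (λ b → ev x (λ a → H a b))
  ev-comm []            y H = sym (ev-zero y)
  ev-comm ((c , a) ∷ x) y H = begin
    c * ev y (H a) + ev x (λ a → ev y (H a))      ≈⟨ +-cong (sym (ev-* y c (H a))) (ev-comm x y H) ⟩
    ev y (λ b → c * H a b) + ev y (λ b → ev x (λ a → H a b)) ≈⟨ sym (ev-+ y _ _) ⟩
    ev y (λ b → c * H a b + ev x (λ a → H a b))  ∎

  δ : List Wc → List Wc → k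
  δ u v = if does (v ≟word u) then 1# else 0#

  δ-cong : ∀ u → Congruent (δ u)
  δ-cong u {a} {b} a≈b with a ≟word u | b ≟word u
  ... | yes _   | yes _   = refl
  ... | yes a≈u | no b≉u  = contradiction (≈W.trans (≈W.sym a≈b) a≈u) b≉u
  ... | no a≉u  | yes b≈u = contradiction (≈W.trans a≈b b≈u) a≉u
  ... | no _    | no _    = refl

  coeff≈ev-δ : ∀ x u → coeff x u ≈k ev x (δ u)
  coeff≈ev-δ []            u = refl
  coeff≈ev-δ ((c , v) ∷ x) u with v ≟word u
  ... | yes _ = +-cong (sym (*-identityʳ c)) (coeff≈ev-δ x u)
  ... | no _  = trans (coeff≈ev-δ x u) (sym (trans (+-congʳ (zeroʳ c)) (+-identityˡ _)))

  remove : List Wc → Tensor → Tensor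
  remove v []            = []
  remove v ((c , w) ∷ x) = if does (w ≟word v) then remove v x else (c , w) ∷ remove v x

  ev-remove : ∀ x v G → Congruent G → ev x G ≈k coeff x v * G v + ev (remove v x) G
  ev-remove []            v G G-cong = sym (trans (+-congʳ (zeroˡ _)) (+-identityˡ _))
  ev-remove ((c , w) ∷ x) v G G-cong with w ≟word v
  ... | yes w≈v = begin
    c * G w + ev x G                                   ≈⟨ +-cong (*-congˡ (G-cong w≈v)) (ev-remove x v G G-cong) ⟩
    c * G v + (coeff x v * G v + ev (remove v x) G)
      ≈⟨ solve 4 (λ c g d r → ((c :* g) :+ ((d :* g) :+ r)) := (((c :+ d) :* g) :+ r)) refl c (G v) (coeff x v) _ ⟩
    (c + coeff x v) * G v + ev (remove v x) G         ∎
  ... | no _ = begin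
    c * G w + ev x G                                   ≈⟨ +-congˡ (ev-remove x v G G-cong) ⟩
    c * G w + (coeff x v * G v + ev (remove v x) G)
      ≈⟨ solve 3 (λ a b r → (a :+ (b :+ r)) := (b :+ (a :+ r))) refl _ _ _ ⟩
    coeff x v * G v + (c * G w + ev (remove v x) G)   ∎

  coeff-remove : ∀ x v u → coeff x u ≈k coeff x v * δ u v + coeff (remove v x) u
  coeff-remove x v u = begin
    coeff x u                                        ≈⟨ coeff≈ev-δ x u ⟩
    ev x (δ u)                                       ≈⟨ ev-remove x v (δ u) (δ-cong u) ⟩
    coeff x v * δ u v + ev (remove v x) (δ u)        ≈⟨ +-congˡ (sym (coeff≈ev-δ (remove v x) u)) ⟩
    coeff x v * δ u v + coeff (remove v x) u         ∎

  remove-length : ∀ v x → length (remove v x) ≤ length x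
  remove-length v []            = z≤n
  remove-length v ((c , w) ∷ x) with w ≟word v
  ... | yes _ = ℕ.m≤n⇒m≤1+n (remove-length v x)
  ... | no _  = s≤s (remove-length v x)

  remove-head : ∀ v c x → remove v ((c , v) ∷ x) ≡.≡ remove v x
  remove-head v c x with v ≟word v
  ... | yes _  = ≡.refl
  ... | no v≉v = contradiction ≈W.refl v≉v

  Null : Tensor → Set
  Null x = ∀ u → coeff x u ≈k 0#

  ev-null : ∀ m x → length x ≤ m → Null x → ∀ G → Congruent G → ev x G ≈k 0#
  ev-null _       []            _          _      _ _      = refl
  ev-null (suc m) x@((c , v) ∷ x') (s≤s |x'|≤m) x-null G G-cong = begin
    ev x G                                  ≈⟨ ev-remove x v G G-cong ⟩
    coeff x v * G v + ev (remove v x) G     ≈⟨ +-cong (trans (*-congʳ (x-null v)) (zeroˡ _))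
                                                      (reflexive (≡.cong (λ y → ev y G) (remove-head v c x'))) ⟩
    0# + ev (remove v x') G                 ≈⟨ +-identityˡ _ ⟩
    ev (remove v x') G                      ≈⟨ ev-null m (remove v x') (ℕ.≤-trans (remove-length v x') |x'|≤m)
                                                       rest-null G G-cong ⟩
    0#                                      ∎
    where
    rest-null : Null (remove v x')
    rest-null u = begin
      coeff (remove v x') u                     ≈⟨ reflexive (≡.cong (λ y → coeff y u) (≡.sym (remove-head v c x'))) ⟩
      coeff (remove v x) u                      ≈⟨ sym (+-identityˡ _) ⟩
      0# + coeff (remove v x) u                 ≈⟨ +-congʳ (sym (trans (*-congʳ (x-null v)) (zeroˡ _))) ⟩
      coeff x v * δ u v + coeff (remove v x) u  ≈⟨ sym (coeff-remove x v u) ⟩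
      coeff x u                                 ≈⟨ x-null u ⟩
      0#                                        ∎

  ≋⇒≃ : ∀ x y → x ≋ y → x ≃ y
  ≋⇒≃ x y x≋y = mk≃ λ G G-cong → begin
    ev x G
      ≈⟨ sym (trans (+-assoc _ _ _) (trans (+-congˡ (-‿inverseˡ _)) (+-identityʳ _))) ⟩
    (ev x G + - ev y G) + ev y G             ≈⟨ +-congʳ (+-congˡ (sym (-1*x≈-x _))) ⟩
    (ev x G + - 1# * ev y G) + ev y G        ≈⟨ +-congʳ (sym (trans (ev-++ x _ G) (+-congˡ (ev-scale (- 1#) y G)))) ⟩
    ev (x ⊖ y) G + ev y G                    ≈⟨ +-congʳ (ev-null (length (x ⊖ y)) (x ⊖ y) ℕ.≤-refl x-y-null G G-cong) ⟩
    0# + ev y G                              ≈⟨ +-identityˡ _ ⟩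
    ev y G                                   ∎
    where
    _⊖_ : Tensor → Tensor → Tensor
    a ⊖ b = a ⊕ scale (- 1#) b
    x-y-null : Null (x ⊖ y)
    x-y-null u = begin
      coeff (x ⊖ y) u                  ≈⟨ coeff≈ev-δ (x ⊖ y) u ⟩
      ev (x ⊖ y) (δ u)                 ≈⟨ trans (ev-++ x _ _) (+-congˡ (ev-scale _ y _)) ⟩
      ev x (δ u) + - 1# * ev y (δ u)   ≈⟨ +-cong (sym (coeff≈ev-δ x u)) (*-congˡ (sym (coeff≈ev-δ y u))) ⟩
      coeff x u + - 1# * coeff y u     ≈⟨ +-congˡ (trans (*-congˡ (sym (x≋y u))) (-1*x≈-x _)) ⟩
      coeff x u + - coeff x u          ≈⟨ -‿inverseʳ _ ⟩
      0#                               ∎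

  ≃⇒≋ : ∀ {x y} → x ≃ y → x ≋ y
  ≃⇒≋ {x} {y} x≃y u = trans (coeff≈ev-δ x u) (trans (ev-≈ x≃y (δ u) (δ-cong u)) (sym (coeff≈ev-δ y u)))

  conjW : Wc → List Wc → List Wc
  conjW u = map (λ x → conj x u)

  Sh : List Wc → List Wc → (List Wc → k) → k
  Sh a b G = ev (shw a b) G

  Sh-[]ˡ : ∀ b G → Sh [] b G ≈k G b
  Sh-[]ˡ b G = trans (+-identityʳ _) (*-identityˡ _)

  Sh-[]ʳ : ∀ a G → Sh a [] G ≈k G a
  Sh-[]ʳ []      G = Sh-[]ˡ [] G
  Sh-[]ʳ (_ ∷ _) G = trans (+-identityʳ _) (*-identityˡ _)

  Sh-∷ : ∀ t ts u us G →
         Sh (t ∷ ts) (u ∷ us) G ≈k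
         Sh ts (u ∷ us) (G ∘ (t ∷_)) + sign (suc (length ts)) * Sh (conjW u (t ∷ ts)) us (G ∘ (u ∷_))
  Sh-∷ t ts u us G = begin
    ev (prefix t (shw ts (u ∷ us)) ⊕ scale σ (prefix u (shw (conjW u (t ∷ ts)) us))) G
      ≈⟨ ev-++ (prefix t (shw ts (u ∷ us))) (scale σ (prefix u (shw (conjW u (t ∷ ts)) us))) G ⟩
    ev (prefix t (shw ts (u ∷ us))) G + ev (scale σ (prefix u (shw (conjW u (t ∷ ts)) us))) G
      ≈⟨ +-cong (reflexive (ev-prefix t (shw ts (u ∷ us)) G))
                (trans (ev-scale σ (prefix u (shw (conjW u (t ∷ ts)) us)) G)
                       (*-congˡ (reflexive (ev-prefix u (shw (conjW u (t ∷ ts)) us) G)))) ⟩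
    Sh ts (u ∷ us) (G ∘ (t ∷_)) + σ * Sh (conjW u (t ∷ ts)) us (G ∘ (u ∷_)) ∎
    where σ = sign (suc (length ts))

  Sh-cong : ∀ {a a' b b' G G'} → a ≈W a' → b ≈W b' → (∀ {d d'} → d ≈W d' → G d ≈k G' d') →
            Sh a b G ≈k Sh a' b' G'
  Sh-cong {G = G} {G'} [] b≈b' G≈G' = trans (Sh-[]ˡ _ G) (trans (G≈G' b≈b') (sym (Sh-[]ˡ _ G')))
  Sh-cong {G = G} {G'} a≈a'@(_ ∷ _) [] G≈G' = trans (Sh-[]ʳ _ G) (trans (G≈G' a≈a') (sym (Sh-[]ʳ _ G')))
  Sh-cong {t ∷ ts} {t' ∷ ts'} {u ∷ us} {u' ∷ us'} {G} {G'} (t≈t' ∷ ts≈ts') (u≈u' ∷ us≈us') G≈G' =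
    begin
      Sh (t ∷ ts) (u ∷ us) G                 ≈⟨ Sh-∷ t ts u us G ⟩
      _ + sign (suc (length ts)) * _
        ≈⟨ +-cong (Sh-cong ts≈ts' (u≈u' ∷ us≈us') (G≈G' ∘ (t≈t' ∷_)))
                  (*-cong (reflexive (≡.cong (sign ∘ suc) (PW.Pointwise-length ts≈ts')))
                          (Sh-cong (conjW-cong (t≈t' ∷ ts≈ts')) us≈us' (G≈G' ∘ (u≈u' ∷_)))) ⟩
      _ + sign (suc (length ts')) * _        ≈⟨ sym (Sh-∷ t' ts' u' us' G') ⟩
      Sh (t' ∷ ts') (u' ∷ us') G'            ∎
    where
    conjW-cong : ∀ {a a'} → a ≈W a' → conjW u a ≈W conjW u' a'
    conjW-cong []         = []
    conjW-cong (x≈x' ∷ p) = conj-cong x≈x' u≈u' ∷ conjW-cong p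

  Sh-congˡ : ∀ {a a'} b G → Congruent G → a ≈W a' → Sh a b G ≈k Sh a' b G
  Sh-congˡ b G G-cong a≈a' = Sh-cong a≈a' (≈W.refl {b}) G-cong

  Sh-congʳ : ∀ a {b b'} G → Congruent G → b ≈W b' → Sh a b G ≈k Sh a b' G
  Sh-congʳ a G G-cong b≈b' = Sh-cong (≈W.refl {a}) b≈b' G-cong

  suc-length-conjW : ∀ u a (b : List Wc) → suc (length (conjW u a) +ℕ length b) ≡.≡ length a +ℕ suc (length b)
  suc-length-conjW u a b =
    ≡.trans (≡.cong (λ m → suc (m +ℕ length b)) (length-map (λ x → conj x u) a)) (≡.sym (ℕ.+-suc (length a) (length b)))

  Sh-cong-length : ∀ a b {H H'} → (∀ d → length d ≡.≡ length a +ℕ length b → H d ≈k H' d) →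
                   Sh a b H ≈k Sh a b H'
  Sh-cong-length []       b        H≈H' = +-congʳ (*-congˡ (H≈H' b ≡.refl))
  Sh-cong-length (t ∷ ts) []       H≈H' = +-congʳ (*-congˡ (H≈H' (t ∷ ts) (≡.sym (ℕ.+-identityʳ _))))
  Sh-cong-length (t ∷ ts) (u ∷ us) {H} {H'} H≈H' = begin
    Sh (t ∷ ts) (u ∷ us) H   ≈⟨ Sh-∷ t ts u us H ⟩
    _ + _ * _                ≈⟨ +-cong (Sh-cong-length ts (u ∷ us) λ d |d| → H≈H' (t ∷ d) (≡.cong suc |d|))
                                       (*-congˡ (Sh-cong-length (conjW u (t ∷ ts)) us λ d |d| →
                                          H≈H' (u ∷ d) (≡.trans (≡.cong suc |d|) (suc-length-conjW u (t ∷ ts) us)))) ⟩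
    _ + _ * _                ≈⟨ sym (Sh-∷ t ts u us H') ⟩
    Sh (t ∷ ts) (u ∷ us) H'  ∎

  conjW-swap : ∀ u v a → conjW v (conjW u a) ≈W conjW (conj u v) (conjW v a)
  conjW-swap u v []      = []
  conjW-swap u v (x ∷ a) = conj-swap x u v ∷ conjW-swap u v a

  Sh-conjW : ∀ v a b H → Congruent H → Sh a b (H ∘ conjW v) ≈k Sh (conjW v a) (conjW v b) H
  Sh-conjW v []       b        H H-cong = refl
  Sh-conjW v (t ∷ ts) []       H H-cong = refl
  Sh-conjW v (t ∷ ts) (u ∷ us) H H-cong = begin
    Sh (t ∷ ts) (u ∷ us) (H ∘ conjW v)
      ≈⟨ Sh-∷ t ts u us (H ∘ conjW v) ⟩
    Sh ts (u ∷ us) (Hᵗ ∘ conjW v) + sign (suc (length ts)) * Sh (conjW u (t ∷ ts)) us (Hᵘ ∘ conjW v)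
      ≈⟨ +-cong (Sh-conjW v ts (u ∷ us) Hᵗ (H-cong ∘ (refl-w ∷_)))
                (*-cong (reflexive (≡.cong (sign ∘ suc) (≡.sym (length-map _ ts))))
                        (trans (Sh-conjW v (conjW u (t ∷ ts)) us Hᵘ (H-cong ∘ (refl-w ∷_)))
                               (Sh-congˡ (conjW v us) Hᵘ (H-cong ∘ (refl-w ∷_)) (conjW-swap u v (t ∷ ts))))) ⟩
    Sh (conjW v ts) (conjW v (u ∷ us)) Hᵗ
      + sign (suc (length (conjW v ts))) * Sh (conjW (conj u v) (conjW v (t ∷ ts))) (conjW v us) Hᵘ
      ≈⟨ sym (Sh-∷ (conj t v) (conjW v ts) (conj u v) (conjW v us) H) ⟩
    Sh (conjW v (t ∷ ts)) (conjW v (u ∷ us)) H ∎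
    where
    Hᵗ = H ∘ (conj t v ∷_)
    Hᵘ = H ∘ (conj u v ∷_)

  sign-+ : ∀ m n → sign (m +ℕ n) ≈k sign m * sign n
  sign-+ zero    n = sym (*-identityˡ _)
  sign-+ (suc m) n = trans (-‿cong (sign-+ m n)) (-‿distribˡ-* (sign m) (sign n))
    where open import Algebra.Properties.Ring ring using (-‿distribˡ-*)

  Sh-expandˡ : ∀ a b t v C G →
    Sh a b (λ d → Sh (t ∷ d) (v ∷ C) G) ≈k
      Sh a b (λ d → Sh d (v ∷ C) (G ∘ (t ∷_)))
      + sign (suc (length a +ℕ length b)) * Sh a b (λ d → Sh (conjW v (t ∷ d)) C (G ∘ (v ∷_)))
  Sh-expandˡ a b t v C G =
    trans (Sh-cong-length a b λ d |d| →
             trans (Sh-∷ t d v C G) (+-congˡ (*-congʳ (reflexive (≡.cong (sign ∘ suc) |d|)))))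
          (ev-linear (shw a b) _ _ _)

  Sh-expandʳ : ∀ b c t A u G →
    Sh b c (λ d → Sh (t ∷ A) (u ∷ d) G) ≈k
      Sh b c (λ d → Sh A (u ∷ d) (G ∘ (t ∷_)))
      + sign (suc (length A)) * Sh b c (λ d → Sh (conjW u (t ∷ A)) d (G ∘ (u ∷_)))
  Sh-expandʳ b c t A u G = trans (ev-cong (shw b c) (λ d → Sh-∷ t A u d G)) (ev-linear (shw b c) _ _ _)

  -- Sh a b (λ d → Sh d c G) evaluates (a ⋆ b) ⋆ c at G.  Expanding both sides twice by the
  -- recursion of shw, the terms in which v comes first are matched by Sh-conjW, the others by
  -- the induction hypotheses.
  Sh-assoc-step : ∀ t A u B v C G → Congruent G →
    let a = t ∷ A ; b = u ∷ B ; c = v ∷ C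
        Gᵗ = G ∘ (t ∷_) ; Gᵘ = G ∘ (u ∷_) ; Gᵛ = G ∘ (v ∷_) in
    Sh A b (λ d → Sh d c Gᵗ) ≈k Sh b c (λ d → Sh A d Gᵗ) →
    Sh (conjW u a) B (λ d → Sh d c Gᵘ) ≈k Sh B c (λ d → Sh (conjW u a) d Gᵘ) →
    Sh (conjW v a) (conjW v b) (λ d → Sh d C Gᵛ) ≈k Sh (conjW v b) C (λ d → Sh (conjW v a) d Gᵛ) →
    Sh a b (λ d → Sh d c G) ≈k Sh b c (λ d → Sh a d G)
  Sh-assoc-step t A u B v C G G-cong IH₁ IH₂ IH₃ = begin
    Sh a b (λ d → Sh d c G)
      ≈⟨ Sh-∷ t A u B (λ d → Sh d c G) ⟩
    Sh A b (λ d → Sh (t ∷ d) c G) + σA * Sh (conjW u a) B (λ d → Sh (u ∷ d) c G)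
      ≈⟨ +-cong (Sh-expandˡ A b t v C G)
                (*-congˡ (trans (Sh-expandˡ (conjW u a) B u v C G) (+-congˡ (*-congʳ (reflexive sign-eq))))) ⟩
    (T₁ + σAb * Y₁) + σA * (T₃ + σAb * Y₃)
      ≈⟨ solve 6 (λ T₁ s Y₁ i T₃ Y₃ → ((T₁ :+ (s :* Y₁)) :+ (i :* (T₃ :+ (s :* Y₃))))
                                   := ((T₁ :+ (i :* T₃)) :+ (s :* (Y₁ :+ (i :* Y₃))))) refl T₁ σAb Y₁ σA T₃ Y₃ ⟩
    (T₁ + σA * T₃) + σAb * (Y₁ + σA * Y₃)
      ≈⟨ +-cong (+-cong IH₁ (*-congˡ IH₂)) (*-cong (sign-+ (suc (length A)) (suc (length B))) Y≈Z) ⟩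
    (Sh b c Q + σA * T₃') + (σA * σB) * Z
      ≈⟨ +-congʳ (+-congʳ (Sh-∷ u B v C Q)) ⟩
    ((Qᵘ + σB * Qᵛ) + σA * T₃') + (σA * σB) * Z
      ≈⟨ solve 6 (λ Qᵘ j Qᵛ i T₃ Z → (((Qᵘ :+ (j :* Qᵛ)) :+ (i :* T₃)) :+ ((i :* j) :* Z))
                                  := ((Qᵘ :+ (i :* T₃)) :+ (j :* (Qᵛ :+ (i :* Z))))) refl Qᵘ σB Qᵛ σA T₃' Z ⟩
    (Qᵘ + σA * T₃') + σB * (Qᵛ + σA * Z)
      ≈⟨ sym (+-cong (Sh-expandʳ B c t A u G) (*-congˡ (Sh-expandʳ (conjW v b) C t A v G))) ⟩
    Sh B c (λ d → Sh a (u ∷ d) G) + σB * Sh (conjW v b) C (λ d → Sh a (v ∷ d) G)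
      ≈⟨ sym (Sh-∷ u B v C (λ d → Sh a d G)) ⟩
    Sh b c (λ d → Sh a d G) ∎
    where
    a = t ∷ A
    b = u ∷ B
    c = v ∷ C
    Gᵗ = G ∘ (t ∷_)
    Gᵘ = G ∘ (u ∷_)
    Gᵛ = G ∘ (v ∷_)
    σA  = sign (suc (length A))
    σB  = sign (suc (length B))
    σAb = sign (suc (length A +ℕ length b))
    Kᵛ = λ d → Sh (conjW v d) C Gᵛ
    T₁ = Sh A b (λ d → Sh d c Gᵗ)
    T₃ = Sh (conjW u a) B (λ d → Sh d c Gᵘ)
    T₃' = Sh B c (λ d → Sh (conjW u a) d Gᵘ)
    Y₁ = Sh A b (Kᵛ ∘ (t ∷_))
    Y₃ = Sh (conjW u a) B (Kᵛ ∘ (u ∷_))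
    Q  = λ d → Sh A d Gᵗ
    Qᵘ = Sh B c (Q ∘ (u ∷_))
    Qᵛ = Sh (conjW v b) C (Q ∘ (v ∷_))
    Z  = Sh (conjW v b) C (λ d → Sh (conjW v a) d Gᵛ)

    sign-eq : sign (suc (length (conjW u a) +ℕ length B)) ≡.≡ σAb
    sign-eq = ≡.cong sign (suc-length-conjW u a B)

    Y≈Z : Y₁ + σA * Y₃ ≈k Z
    Y≈Z = begin
      Y₁ + σA * Y₃                        ≈⟨ sym (Sh-∷ t A u B Kᵛ) ⟩
      Sh a b Kᵛ                           ≈⟨ Sh-conjW v a b (λ d → Sh d C Gᵛ) (Sh-congˡ C Gᵛ (G-cong ∘ (refl-w ∷_))) ⟩
      Sh (conjW v a) (conjW v b) (λ d → Sh d C Gᵛ) ≈⟨ IH₃ ⟩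
      Z                                   ∎

  Sh-assoc : ∀ a b c G → Congruent G → Sh a b (λ d → Sh d c G) ≈k Sh b c (λ d → Sh a d G)
  Sh-assoc []      b       c       G _ = trans (Sh-[]ˡ b (λ d → Sh d c G)) (sym (ev-cong (shw b c) (λ d → Sh-[]ˡ d G)))
  Sh-assoc (t ∷ A) []      c       G _ = trans (Sh-[]ʳ (t ∷ A) (λ d → Sh d c G)) (sym (Sh-[]ˡ c (λ d → Sh (t ∷ A) d G)))
  Sh-assoc (t ∷ A) (u ∷ B) []      G _ =
    trans (ev-cong (shw (t ∷ A) (u ∷ B)) (λ d → Sh-[]ʳ d G)) (sym (Sh-[]ʳ (u ∷ B) (λ d → Sh (t ∷ A) d G)))
  Sh-assoc (t ∷ A) (u ∷ B) (v ∷ C) G G-cong =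
    Sh-assoc-step t A u B v C G G-cong
      (Sh-assoc A (u ∷ B) (v ∷ C) _ (G-cong ∘ (refl-w ∷_)))
      (Sh-assoc (conjW u (t ∷ A)) B (v ∷ C) _ (G-cong ∘ (refl-w ∷_)))
      (Sh-assoc (conjW v (t ∷ A)) (conjW v (u ∷ B)) C _ (G-cong ∘ (refl-w ∷_)))

  ev-⋆ : ∀ x y G → ev (x ⋆ y) G ≈k ev x (λ a → ev y (λ b → Sh a b G))
  ev-⋆ []            y G = refl
  ev-⋆ ((c , a) ∷ x) y G = trans (ev-++ (row y) (x ⋆ y) G) (+-cong (ev-row y) (ev-⋆ x y G))
    where
    row : Tensor → Tensor
    row = concatMap (λ q → scale (c * proj₁ q) (shw a (proj₂ q)))
    ev-row : ∀ y → ev (row y) G ≈k c * ev y (λ b → Sh a b G)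
    ev-row []            = sym (zeroʳ c)
    ev-row ((d , b) ∷ y) = begin
      ev (scale (c * d) (shw a b) ++ row y) G        ≈⟨ ev-++ (scale (c * d) (shw a b)) (row y) G ⟩
      ev (scale (c * d) (shw a b)) G + ev (row y) G  ≈⟨ +-cong (ev-scale (c * d) (shw a b) G) (ev-row y) ⟩
      (c * d) * Sh a b G + c * ev y (λ b → Sh a b G)
        ≈⟨ solve 4 (λ c d e f → (((c :* d) :* e) :+ (c :* f)) := (c :* ((d :* e) :+ f))) refl c d (Sh a b G) _ ⟩
      c * (d * Sh a b G + ev y (λ b → Sh a b G))     ∎

  ⋆-cong : ∀ {x x' y y'} → x ≃ x' → y ≃ y' → x ⋆ y ≃ x' ⋆ y'
  ⋆-cong {x} {x'} {y} {y'} x≃x' y≃y' = mk≃ λ G G-cong → begin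
    ev (x ⋆ y) G                          ≈⟨ ev-⋆ x y G ⟩
    ev x (λ a → ev y (λ b → Sh a b G))    ≈⟨ ev-≈ x≃x' _ (λ a≈a' → ev-cong y (λ b → Sh-congˡ b G G-cong a≈a')) ⟩
    ev x' (λ a → ev y (λ b → Sh a b G))   ≈⟨ ev-cong x' (λ a → ev-≈ y≃y' _ (Sh-congʳ a G G-cong)) ⟩
    ev x' (λ a → ev y' (λ b → Sh a b G))  ≈⟨ sym (ev-⋆ x' y' G) ⟩
    ev (x' ⋆ y') G                        ∎

  ⋆-assoc : ∀ x y z → (x ⋆ y) ⋆ z ≃ x ⋆ (y ⋆ z)
  ⋆-assoc x y z = mk≃ λ G G-cong → begin
    ev ((x ⋆ y) ⋆ z) G                                       ≈⟨ ev-⋆ (x ⋆ y) z G ⟩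
    ev (x ⋆ y) (λ d → ev z (λ c → Sh d c G))                 ≈⟨ ev-⋆ x y _ ⟩
    ev x (λ a → ev y (λ b → Sh a b (λ d → ev z (λ c → Sh d c G))))
      ≈⟨ ev-cong x (λ a → ev-cong y (λ b → ev-comm (shw a b) z (λ d c → Sh d c G))) ⟩
    ev x (λ a → ev y (λ b → ev z (λ c → Sh a b (λ d → Sh d c G))))
      ≈⟨ ev-cong x (λ a → ev-cong y (λ b → ev-cong z (λ c → Sh-assoc a b c G G-cong))) ⟩
    ev x (λ a → ev y (λ b → ev z (λ c → Sh b c (λ d → Sh a d G))))
      ≈⟨ ev-cong x (λ a → sym (ev-⋆ y z (λ d → Sh a d G))) ⟩
    ev x (λ a → ev (y ⋆ z) (λ d → Sh a d G))                 ≈⟨ sym (ev-⋆ x (y ⋆ z) G) ⟩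
    ev (x ⋆ (y ⋆ z)) G                                       ∎

  ⋆-identityˡ : ∀ x → oneT ⋆ x ≃ x
  ⋆-identityˡ x = mk≃ λ G _ →
    trans (ev-⋆ oneT x G) (trans (+-identityʳ _) (trans (*-identityˡ _) (ev-cong x (λ b → Sh-[]ˡ b G))))

  ⋆-identityʳ : ∀ x → x ⋆ oneT ≃ x
  ⋆-identityʳ x = mk≃ λ G _ →
    trans (ev-⋆ x oneT G) (ev-cong x (λ a → trans (+-identityʳ _) (trans (*-identityˡ _) (Sh-[]ʳ a G))))

  ⋆-zeroʳ : ∀ x → x ⋆ zeroT ≃ zeroT
  ⋆-zeroʳ x = mk≃ λ G _ → trans (ev-⋆ x zeroT G) (ev-zero x)

  ⋆-distribʳ-⊕ : ∀ x x' y → (x ⊕ x') ⋆ y ≃ (x ⋆ y) ⊕ (x' ⋆ y)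
  ⋆-distribʳ-⊕ x x' y = mk≃ λ G _ → begin
    ev ((x ⊕ x') ⋆ y) G                  ≈⟨ ev-⋆ (x ⊕ x') y G ⟩
    ev (x ⊕ x') _                        ≈⟨ ev-++ x x' _ ⟩
    ev x _ + ev x' _                     ≈⟨ sym (+-cong (ev-⋆ x y G) (ev-⋆ x' y G)) ⟩
    ev (x ⋆ y) G + ev (x' ⋆ y) G         ≈⟨ sym (ev-++ (x ⋆ y) _ G) ⟩
    ev ((x ⋆ y) ⊕ (x' ⋆ y)) G            ∎

  ⋆-distribˡ-⊕ : ∀ x y y' → x ⋆ (y ⊕ y') ≃ (x ⋆ y) ⊕ (x ⋆ y')
  ⋆-distribˡ-⊕ x y y' = mk≃ λ G _ → begin
    ev (x ⋆ (y ⊕ y')) G                                         ≈⟨ ev-⋆ x (y ⊕ y') G ⟩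
    ev x (λ a → ev (y ⊕ y') (λ b → Sh a b G))                   ≈⟨ ev-cong x (λ a → ev-++ y y' _) ⟩
    ev x (λ a → ev y (λ b → Sh a b G) + ev y' (λ b → Sh a b G)) ≈⟨ ev-+ x _ _ ⟩
    ev x _ + ev x _                                             ≈⟨ sym (+-cong (ev-⋆ x y G) (ev-⋆ x y' G)) ⟩
    ev (x ⋆ y) G + ev (x ⋆ y') G                                ≈⟨ sym (ev-++ (x ⋆ y) _ G) ⟩
    ev ((x ⋆ y) ⊕ (x ⋆ y')) G                                   ∎

  scale-⋆ : ∀ c x y → scale c x ⋆ y ≃ scale c (x ⋆ y)
  scale-⋆ c x y = mk≃ λ G _ → begin
    ev (scale c x ⋆ y) G       ≈⟨ ev-⋆ (scale c x) y G ⟩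
    ev (scale c x) _           ≈⟨ ev-scale c x _ ⟩
    c * ev x _                 ≈⟨ *-congˡ (sym (ev-⋆ x y G)) ⟩
    c * ev (x ⋆ y) G           ≈⟨ sym (ev-scale c (x ⋆ y) G) ⟩
    ev (scale c (x ⋆ y)) G     ∎

  ⋆-scale : ∀ c x y → x ⋆ scale c y ≃ scale c (x ⋆ y)
  ⋆-scale c x y = mk≃ λ G _ → begin
    ev (x ⋆ scale c y) G                          ≈⟨ ev-⋆ x (scale c y) G ⟩
    ev x (λ a → ev (scale c y) (λ b → Sh a b G))  ≈⟨ ev-cong x (λ a → ev-scale c y _) ⟩
    ev x (λ a → c * ev y (λ b → Sh a b G))        ≈⟨ ev-* x c _ ⟩
    c * ev x _                                    ≈⟨ *-congˡ (sym (ev-⋆ x y G)) ⟩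
    c * ev (x ⋆ y) G                              ≈⟨ sym (ev-scale c (x ⋆ y) G) ⟩
    ev (scale c (x ⋆ y)) G                        ∎

  ⊕-cong : ∀ {x x' y y'} → x ≃ x' → y ≃ y' → x ⊕ y ≃ x' ⊕ y'
  ⊕-cong {x} {x'} {y} {y'} x≃x' y≃y' = mk≃ λ G G-cong →
    trans (ev-++ x y G) (trans (+-cong (ev-≈ x≃x' G G-cong) (ev-≈ y≃y' G G-cong)) (sym (ev-++ x' y' G)))

  ⊕-assoc : ∀ x y z → (x ⊕ y) ⊕ z ≃ x ⊕ (y ⊕ z)
  ⊕-assoc x y z = mk≃ λ G _ → begin
    ev ((x ⊕ y) ⊕ z) G          ≈⟨ trans (ev-++ (x ⊕ y) z G) (+-congʳ (ev-++ x y G)) ⟩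
    (ev x G + ev y G) + ev z G  ≈⟨ +-assoc _ _ _ ⟩
    ev x G + (ev y G + ev z G)  ≈⟨ sym (trans (ev-++ x (y ⊕ z) G) (+-congˡ (ev-++ y z G))) ⟩
    ev (x ⊕ (y ⊕ z)) G          ∎

  ⊕-identityʳ : ∀ x → x ⊕ zeroT ≃ x
  ⊕-identityʳ x = mk≃ λ G _ → trans (ev-++ x zeroT G) (+-identityʳ _)

  scale-cong : ∀ c {x x'} → x ≃ x' → scale c x ≃ scale c x'
  scale-cong c {x} {x'} x≃x' = mk≃ λ G G-cong →
    trans (ev-scale c x G) (trans (*-congˡ (ev-≈ x≃x' G G-cong)) (sym (ev-scale c x' G)))

  scale-identity : ∀ x → scale 1# x ≃ x
  scale-identity x = mk≃ λ G _ → trans (ev-scale 1# x G) (*-identityˡ _)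

  scale-scale : ∀ c d x → scale c (scale d x) ≃ scale (c * d) x
  scale-scale c d x = mk≃ λ G _ →
    trans (ev-scale c (scale d x) G)
          (trans (*-congˡ (ev-scale d x G)) (trans (sym (*-assoc _ _ _)) (sym (ev-scale (c * d) x G))))

  scale-distrib-⊕ : ∀ c x y → scale c (x ⊕ y) ≃ scale c x ⊕ scale c y
  scale-distrib-⊕ c x y = mk≃ λ G _ → begin
    ev (scale c (x ⊕ y)) G                   ≈⟨ ev-scale c (x ⊕ y) G ⟩
    c * ev (x ⊕ y) G                         ≈⟨ *-congˡ (ev-++ x y G) ⟩
    c * (ev x G + ev y G)                    ≈⟨ distribˡ c _ _ ⟩
    c * ev x G + c * ev y G                  ≈⟨ sym (+-cong (ev-scale c x G) (ev-scale c y G)) ⟩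
    ev (scale c x) G + ev (scale c y) G      ≈⟨ sym (ev-++ (scale c x) _ G) ⟩
    ev (scale c x ⊕ scale c y) G             ∎

  starProd-++ : ∀ a b → starProd a ⋆ starProd b ≃ starProd (a ++ b)
  starProd-++ []      b = ⋆-identityˡ (starProd b)
  starProd-++ (t ∷ a) b = ≃-trans (⋆-assoc (gen t) (starProd a) (starProd b)) (⋆-cong (≃-refl {gen t}) (starProd-++ a b))

  sumT-++ : ∀ {A : Set} (f : A → Tensor) as bs → sumT (map f (as ++ bs)) ≃ sumT (map f as) ⊕ sumT (map f bs)
  sumT-++ f []       bs = ≃-refl
  sumT-++ f (a ∷ as) bs = ≃-trans (⊕-cong (≃-refl {f a}) (sumT-++ f as bs)) (≃-sym (⊕-assoc (f a) _ _))

  scale-sumT : ∀ {A B : Set} c (f : A → Tensor) (g : A → B) (h : B → Tensor) →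
               (∀ a → h (g a) ≃ scale c (f a)) → ∀ as → scale c (sumT (map f as)) ≃ sumT (map h (map g as))
  scale-sumT c f g h h∘g≃cf []       = ≃-refl
  scale-sumT c f g h h∘g≃cf (a ∷ as) =
    ≃-trans (scale-distrib-⊕ c (f a) _) (⊕-cong (≃-sym (h∘g≃cf a)) (scale-sumT c f g h h∘g≃cf as))

  sumT-⋆ : ∀ {A B C : Set} (f : A → Tensor) (g : B → Tensor) (h : C → Tensor) (_·_ : A → B → C) →
           (∀ a b → h (a · b) ≃ f a ⋆ g b) → ∀ as bs →
           sumT (map f as) ⋆ sumT (map g bs) ≃ sumT (map h (cartesianProductWith _·_ as bs))
  sumT-⋆ f g h _·_ h·≃⋆ []       bs = ≃-refl
  sumT-⋆ f g h _·_ h·≃⋆ (a ∷ as) bs =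
    ≃-trans (⋆-distribʳ-⊕ (f a) (sumT (map f as)) (sumT (map g bs)))
    (≃-trans (⊕-cong (row bs) (sumT-⋆ f g h _·_ h·≃⋆ as bs))
             (≃-sym (sumT-++ h (map (a ·_) bs) (cartesianProductWith _·_ as bs))))
    where
    row : ∀ bs → f a ⋆ sumT (map g bs) ≃ sumT (map h (map (a ·_) bs))
    row []       = ⋆-zeroʳ (f a)
    row (b ∷ bs) = ≃-trans (⋆-distribˡ-⊕ (f a) (g b) _) (⊕-cong (≃-sym (h·≃⋆ a b)) (row bs))

  IsFactorisation : Wc → ℕ → List Wc → Set
  IsFactorisation w j ts = length ts ≡.≡ j × All IsRefl ts × prod ts ≈w w

  term : k × List Wc → Tensor
  term p = scale (proj₁ p) (starProd (proj₂ p))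

  combination : List (k × List Wc) → Tensor
  combination L = sumT (map term L)

  prod-++ : ∀ a b → prod (a ++ b) ≈w prod a · prod b
  prod-++ []      b = sym-w (identityˡ _)
  prod-++ (t ∷ a) b = trans-w (∙-congˡ (prod-++ a b)) (sym-w (assoc _ _ _))

  IsFactorisation-++ : ∀ {w j w' j' a b} → IsFactorisation w j a → IsFactorisation w' j' b →
                       IsFactorisation (w · w') (j +ℕ j') (a ++ b)
  IsFactorisation-++ {a = a} {b} (|a| , Ta , a≈w) (|b| , Tb , b≈w') =
    ≡.trans (length-++ a) (≡.cong₂ _+ℕ_ |a| |b|) , ++⁺ Ta Tb , trans-w (prod-++ a b) (∙-cong a≈w b≈w')

  termProduct : k × List Wc → k × List Wc → k × List Wc
  termProduct (c , a) (d , b) = c * d , a ++ b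

  term-⋆ : ∀ p q → term (termProduct p q) ≃ term p ⋆ term q
  term-⋆ (c , a) (d , b) = ≃-sym (
    ≃-trans (scale-⋆ c (starProd a) (scale d (starProd b)))
    (≃-trans (scale-cong c (⋆-scale d (starProd a) (starProd b)))
    (≃-trans (scale-scale c d _) (scale-cong (c * d) (starProd-++ a b)))))

  combination-⋆ : ∀ L L' → combination L ⋆ combination L' ≃ combination (cartesianProductWith termProduct L L')
  combination-⋆ = sumT-⋆ term term term termProduct term-⋆

  Nwj-⋆ : ∀ w j w' j' x y → InNwj w j x → InNwj w' j' y → InNwj (w · w') (j +ℕ j') (x ⋆ y)
  Nwj-⋆ w j w' j' x y (L , fL , x≋L) (L' , fL' , y≋L') =
    cartesianProductWith termProduct L L' ,
    All-cartesianProductWith (λ {p} {q} → IsFactorisation-++ {a = proj₂ p} {proj₂ q}) fL fL' ,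
    ≃⇒≋ (≃-trans (⋆-cong (≋⇒≃ x (combination L) x≋L) (≋⇒≃ y (combination L') y≋L')) (combination-⋆ L L'))

  zero∈N : InN zeroT
  zero∈N = n-resp (≃⇒≋ {scale 0# oneT} {zeroT} (mk≃ λ G _ →
                     trans (+-identityʳ _) (trans (*-congʳ (zeroˡ 1#)) (zeroˡ _))))
                  (n-scale 0# n-one)

  starProd∈N : ∀ {ts} → All IsRefl ts → InN (starProd ts)
  starProd∈N []       = n-one
  starProd∈N (r ∷ rs) = n-mul (n-gen _ r) (starProd∈N rs)

  combination∈N : ∀ {w j} L → All (IsFactorisation w j ∘ proj₂) L → InN (combination L)
  combination∈N []      []                  = zero∈N
  combination∈N (p ∷ L) ((_ , rs , _) ∷ fL) = n-add (n-scale (proj₁ p) (starProd∈N rs)) (combination∈N L fL)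

  Nwj⊆N : ∀ w j x → InNwj w j x → InN x
  Nwj⊆N w j x (L , fL , x≋L) = n-resp (λ u → sym (x≋L u)) (combination∈N L fL)

  Nwj-scale : ∀ c w j x → InNwj w j x → InNwj w j (scale c x)
  Nwj-scale c w j x (L , fL , x≋L) =
    map scaleTerm L , map⁺ fL ,
    ≃⇒≋ (≃-trans (scale-cong c (≋⇒≃ x (combination L) x≋L))
                 (scale-sumT c term scaleTerm term (λ p → ≃-sym (scale-scale c (proj₁ p) (starProd (proj₂ p)))) L))
    where
    scaleTerm : k × List Wc → k × List Wc
    scaleTerm (d , ts) = c * d , ts

  scaleComponent : k → Component → Component
  scaleComponent c (w , j , x) = w , j , scale c x

  componentProduct : Component → Component → Component
  componentProduct (w , j , x) (w' , j' , y) = w · w' , j +ℕ j' , x ⋆ y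

  InComponent-scale : ∀ c q → InComponent q → InComponent (scaleComponent c q)
  InComponent-scale c (w , j , x) = Nwj-scale c w j x

  InComponent-⋆ : ∀ q q' → InComponent q → InComponent q' → InComponent (componentProduct q q')
  InComponent-⋆ (w , j , x) (w' , j' , y) = Nwj-⋆ w j w' j' x y

  decompose : ∀ {x} → InN x → ∃ λ (L : List Component) → All InComponent L × x ≃ sumT (map vec L)
  decompose n-one =
    (e , 0 , oneT) ∷ [] ,
    ((1# , []) ∷ [] , (≡.refl , [] , refl-w) ∷ [] ,
      ≃⇒≋ (≃-sym (≃-trans (⊕-identityʳ (scale 1# oneT)) (scale-identity oneT)))) ∷ [] ,
    ≃-sym (⊕-identityʳ oneT)
  decompose (n-gen t t∈T) =
    (t , 1 , gen t) ∷ [] ,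
    ((1# , t ∷ []) ∷ [] , (≡.refl , t∈T ∷ [] , identityʳ t) ∷ [] ,
      ≃⇒≋ (≃-sym (≃-trans (⊕-identityʳ _) (≃-trans (scale-identity (gen t ⋆ oneT)) (⋆-identityʳ (gen t)))))) ∷ [] ,
    ≃-sym (⊕-identityʳ (gen t))
  decompose (n-add x∈N y∈N) with decompose x∈N | decompose y∈N
  ... | L , cL , x≃L | L' , cL' , y≃L' =
    L ++ L' , ++⁺ cL cL' , ≃-trans (⊕-cong x≃L y≃L') (≃-sym (sumT-++ vec L L'))
  decompose (n-scale c x∈N) with decompose x∈N
  ... | L , cL , x≃L =
    map (scaleComponent c) L , gmap⁺ (λ {q} → InComponent-scale c q) cL ,
    ≃-trans (scale-cong c x≃L) (scale-sumT c vec (scaleComponent c) vec (λ _ → ≃-refl) L)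
  decompose (n-mul x∈N y∈N) with decompose x∈N | decompose y∈N
  ... | L , cL , x≃L | L' , cL' , y≃L' =
    cartesianProductWith componentProduct L L' , All-cartesianProductWith (λ {q} {q'} → InComponent-⋆ q q') cL cL' ,
    ≃-trans (⋆-cong x≃L y≃L') (sumT-⋆ vec vec vec componentProduct (λ _ _ → ≃-refl) L L')
  decompose (n-resp {x} {y} x≋y x∈N) with decompose x∈N
  ... | L , cL , x≃L = L , cL , ≃-trans (≃-sym (≋⇒≃ x y x≋y)) x≃L

  N-decomposition : ∀ x → InN x → ∃ λ (L : List Component) → All InComponent L × x ≋ sumT (map vec L)
  N-decomposition x x∈N with decompose x∈N
  ... | L , cL , x≃L = L , cL , ≃⇒≋ x≃L

  Vanishes : Wc → ℕ → (List Wc → k) → Set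
  Vanishes w j G = ∀ d → length d ≡.≡ j → prod d ≈w w → G d ≈k 0#

  SupportedOn : Wc → ℕ → Tensor → Set
  SupportedOn w j x = ∀ G → Congruent G → Vanishes w j G → ev x G ≈k 0#

  prod-conjW : ∀ u a → prod (conjW u a) ≈w conj (prod a) u
  prod-conjW u []      = sym-w (conj-ε u)
  prod-conjW u (t ∷ a) = trans-w (∙-congˡ (prod-conjW u a)) (conj-homo-∙ t (prod a) u)

  prod-cong : ∀ {a b} → a ≈W b → prod a ≈w prod b
  prod-cong []          = refl-w
  prod-cong (x≈y ∷ a≈b) = ∙-cong x≈y (prod-cong a≈b)

  Sh-vanishes : ∀ a b G → Vanishes (prod a · prod b) (length a +ℕ length b) G → Sh a b G ≈k 0#
  Sh-vanishes []         b        G G-van = trans (Sh-[]ˡ b G) (G-van b ≡.refl (sym-w (identityˡ _)))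
  Sh-vanishes a@(_ ∷ _)  []       G G-van =
    trans (Sh-[]ʳ a G) (G-van a (≡.sym (ℕ.+-identityʳ _)) (sym-w (identityʳ _)))
  Sh-vanishes a@(t ∷ ts) (u ∷ us) G G-van = begin
    Sh a (u ∷ us) G                                        ≈⟨ Sh-∷ t ts u us G ⟩
    _ + sign (suc (length ts)) * _                         ≈⟨ +-cong (Sh-vanishes ts (u ∷ us) _ vanishesᵗ)
                                                                     (*-congˡ (Sh-vanishes (conjW u a) us _ vanishesᵘ)) ⟩
    0# + sign (suc (length ts)) * 0#                       ≈⟨ trans (+-identityˡ _) (zeroʳ _) ⟩
    0#                                                     ∎
    where
    vanishesᵗ : Vanishes (prod ts · prod (u ∷ us)) (length ts +ℕ length (u ∷ us)) (G ∘ (t ∷_))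
    vanishesᵗ d |d| d≈ = G-van (t ∷ d) (≡.cong suc |d|) (trans-w (∙-congˡ d≈) (sym-w (assoc _ _ _)))

    vanishesᵘ : Vanishes (prod (conjW u a) · prod us) (length (conjW u a) +ℕ length us) (G ∘ (u ∷_))
    vanishesᵘ d |d| d≈ = G-van (u ∷ d) (≡.trans (≡.cong suc |d|) (suc-length-conjW u a us))
      (trans-w (∙-congˡ (trans-w d≈ (∙-congʳ (prod-conjW u a)))) (∙-conj-∙ u (prod a) (prod us)))

  starProd-supported : ∀ ts → SupportedOn (prod ts) (length ts) (starProd ts)
  starProd-supported []       G _      G-van = trans (+-identityʳ _) (trans (*-identityˡ _) (G-van [] ≡.refl refl-w))
  starProd-supported (t ∷ ts) G G-cong G-van =
    trans (ev-⋆ (gen t) (starProd ts) G)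
    (trans (+-identityʳ _) (trans (*-identityˡ _)
    (starProd-supported ts (λ b → Sh (t ∷ []) b G) (Sh-congʳ (t ∷ []) G G-cong) λ b |b| b≈ →
       Sh-vanishes (t ∷ []) b G λ d |d| d≈ →
         G-van d (≡.trans |d| (≡.cong suc |b|)) (trans-w d≈ (trans-w (∙-congʳ (identityʳ t)) (∙-congˡ b≈))))))

  combination-supported : ∀ {w j} L → All (IsFactorisation w j ∘ proj₂) L → SupportedOn w j (combination L)
  combination-supported []             []                          G _      _     = refl
  combination-supported ((c , ts) ∷ L) ((|ts| , _ , ts≈w) ∷ fL) G G-cong G-van = begin
    ev (term (c , ts) ⊕ combination L) G            ≈⟨ ev-++ (term (c , ts)) (combination L) G ⟩
    ev (term (c , ts)) G + ev (combination L) G     ≈⟨ +-cong (ev-scale c (starProd ts) G)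
                                                              (combination-supported L fL G G-cong G-van) ⟩
    c * ev (starProd ts) G + 0#                     ≈⟨ +-congʳ (*-congˡ (starProd-supported ts G G-cong
                                                         λ d |d| d≈ → G-van d (≡.trans |d| |ts|) (trans-w d≈ ts≈w))) ⟩
    c * 0# + 0#                                     ≈⟨ trans (+-identityʳ _) (zeroʳ c) ⟩
    0#                                              ∎

  Nwj-supported : ∀ w j x → InNwj w j x → SupportedOn w j x
  Nwj-supported w j x (L , fL , x≋L) G G-cong G-van =
    trans (ev-≈ (≋⇒≃ x (combination L) x≋L) G G-cong) (combination-supported L fL G G-cong G-van)

  coeff-off-support : ∀ w j x → InNwj w j x → ∀ u → ¬ (length u ≡.≡ j × prod u ≈w w) → coeff x u ≈k 0#
  coeff-off-support w j x x∈Nwj u u-off =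
    trans (coeff≈ev-δ x u) (Nwj-supported w j x x∈Nwj (δ u) (δ-cong u) δ-vanishes)
    where
    δ-vanishes : Vanishes w j (δ u)
    δ-vanishes d |d| d≈w with d ≟word u
    ... | yes d≈u = contradiction
                      (≡.trans (≡.sym (PW.Pointwise-length d≈u)) |d| , trans-w (sym-w (prod-cong d≈u)) d≈w) u-off
    ... | no _    = refl

  coeff-++ : ∀ x y u → coeff (x ⊕ y) u ≈k coeff x u + coeff y u
  coeff-++ x y u =
    trans (coeff≈ev-δ (x ⊕ y) u) (trans (ev-++ x y (δ u)) (sym (+-cong (coeff≈ev-δ x u) (coeff≈ev-δ y u))))

  coeff-other-components : ∀ {w j} c u → length u ≡.≡ j → prod u ≈w w → ∀ L →
                           All (index≠ (w , j , c)) L → All InComponent L → coeff (sumT (map vec L)) u ≈k 0#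
  coeff-other-components c u |u| u≈w []                  []           []          = refl
  coeff-other-components c u |u| u≈w ((w' , j' , x) ∷ L) (≠ ∷ ≠L) (x∈N ∷ L∈N) = begin
    coeff (x ⊕ sumT (map vec L)) u                 ≈⟨ coeff-++ x _ u ⟩
    coeff x u + coeff (sumT (map vec L)) u
      ≈⟨ +-cong (coeff-off-support w' j' x x∈N u λ (|u|' , u≈w') →
                   ≠ (trans-w (sym-w u≈w) u≈w' , ≡.trans (≡.sym |u|) |u|'))
                (coeff-other-components c u |u| u≈w L ≠L L∈N) ⟩
    0# + 0#                                        ≈⟨ +-identityʳ _ ⟩
    0#                                             ∎

  components-independent : ∀ (L : List Component) → AllPairs index≠ L → All InComponent L →
                           sumT (map vec L) ≋ zeroT → All (λ c → vec c ≋ zeroT) L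
  components-independent []                  _          _           _     = []
  components-independent ((w , j , x) ∷ L) (≠L ∷ ≠s) (x∈N ∷ L∈N) total = x≋0 ∷ components-independent L ≠s L∈N rest≋0
    where
    rest = sumT (map vec L)

    x≋0 : x ≋ zeroT
    x≋0 u with length u ≟ℕ j ×-dec prod u ≟ w
    ... | no off            = coeff-off-support w j x x∈N u off
    ... | yes (|u| , u≈w) = begin
      coeff x u                   ≈⟨ sym (+-identityʳ _) ⟩
      coeff x u + 0#              ≈⟨ +-congˡ (sym (coeff-other-components x u |u| u≈w L ≠L L∈N)) ⟩
      coeff x u + coeff rest u    ≈⟨ sym (coeff-++ x rest u) ⟩
      coeff (x ⊕ rest) u          ≈⟨ total u ⟩
      0#                          ∎

    rest≋0 : rest ≋ zeroT
    rest≋0 u = begin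
      coeff rest u                ≈⟨ sym (+-identityˡ _) ⟩
      0# + coeff rest u           ≈⟨ +-congʳ (sym (x≋0 u)) ⟩
      coeff x u + coeff rest u    ≈⟨ sym (coeff-++ x rest u) ⟩
      coeff (x ⊕ rest) u          ≈⟨ total u ⟩
      0#                          ∎

  Nwj-nonzero⇒factorisation : ∀ w j x → InNwj w j x → ¬ (x ≋ zeroT) → ∃ (IsFactorisation w j)
  Nwj-nonzero⇒factorisation w j x ([]          , _       , x≋0) x≉0 = contradiction x≋0 x≉0
  Nwj-nonzero⇒factorisation w j x ((_ , ts) ∷ _ , fts ∷ _ , _)  _   = ts , fts

lemma7p3 : (k : Field) (W : Group 0ℓ 0ℓ) (S : Group.Carrier W → Set)
    (n : ℕ) (finite : Inverse (Group.setoid W) (≡.setoid (Fin n))) →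
    IsCoxeterSystem W S →
    TwistedShuffle.Lemma7p3 k W (finite⇒dec W n finite) S
lemma7p3 k W S n finite cox =
  Nwj⊆N , N-decomposition , components-independent , Nwj-⋆ ,
  λ { w j (x , x∈Nwj , x≉0) → reflection-length (Nwj-nonzero⇒factorisation w j x x∈Nwj x≉0) }
  where
  open ShuffleAlgebra k W (finite⇒dec W n finite) S
  open Coxeter W S n finite cox using (reflection-length)
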